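{- For all retractable contracts $\rho,\sigma$: if $\rho$ is compliant with $\sigma$, then the judgment $\rhd\rho\dashv\sigma$ (with empty set of assumptions) is derivable in the formal system for compliance.
   Context: Retractable contracts: closed expressions of $\sigma ::= \mathbf 1 \mid \sum_{i\in I} a_i.\sigma_i \mid \sum_{i\in I}\overline a_i.\sigma_i \mid \bigoplus_{i\in I}\overline a_i.\sigma_i \mid x \mid \mathsf{rec}\,x.\sigma$ over names $a$ and conames $\overline a$, $I$ non-empty finite, pairwise distinct (co)names per choice, $\sigma$ not a variable in $\mathsf{rec}\,x.\sigma$; equi-recursive, choices commutative, unary outputs of both kinds identified; $\alpha$ ranges over names and conames, $\overline{\overline a}=a$. Histories: $\vec\gamma::=[\,]\mid\vec\gamma:\sigma$ with $\sigma$ a contract or the symbol $\circ$. LTS: $\langle\vec\gamma\rangle(\alpha.\sigma+\sigma')\xrightarrow{\alpha}\langle\vec\gamma:\sigma'\rangle\sigma$; $\langle\vec\gamma\rangle(\overline a.\sigma\oplus\sigma')\xrightarrow{\tau}\langle\vec\gamma\rangle\overline a.\sigma$; $\langle\vec\gamma\rangle\alpha.\sigma\xrightarrow{\alpha}\langle\vec\gamma:\circ\rangle\sigma$; $\langle\vec\gamma:\sigma'\rangle\sigma\xrightarrow{\mathsf{rb}}\langle\vec\gamma\rangle\sigma'$. Pair reduction: (comm) client does $\alpha$, server does $\overline\alpha$, both move; ($\tau$) a $\tau$-step of either side alone; (rbk) if the client's current contract $\neq\mathbf 1$ and both sides can do $\mathsf{rb}$, both do it, applicable only when neither (comm) nor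 ($\tau$) applies. Compliance: $\rho$ is compliant with $\sigma$ if whenever $\langle[\,]\rangle\rho\,\|\,\langle[\,]\rangle\sigma\to^*\langle\vec\delta'\rangle\rho'\,\|\,\langle\vec\gamma'\rangle\sigma'$ and the latter has no reduction, then $\rho'=\mathbf 1$. Formal system (judgments $\Gamma\rhd\rho\dashv\sigma$, $\Gamma$ a set of $\rho'\dashv\sigma'$): (Ax) $\Gamma\rhd\mathbf 1\dashv\sigma$; (Hyp) $\Gamma,\rho\dashv\sigma\rhd\rho\dashv\sigma$; (+,+) from $\Gamma,\alpha.\rho+\rho'\dashv\overline\alpha.\sigma+\sigma'\rhd\rho\dashv\sigma$ infer $\Gamma\rhd\alpha.\rho+\rho'\dashv\overline\alpha.\sigma+\sigma'$; $(\oplus,+)$ from $\Gamma,\bigoplus_{i\in I}\overline a_i.\rho_i\dashv\sum_{j\in I\cup J}a_j.\sigma_j\rhd\rho_i\dashv\sigma_i$ ($\forall i\in I$) infer $\Gamma\rhd\bigoplus_{i\in I}\overline a_i.\rho_i\dashv\sum_{j\in I\cup J}a_j.\sigma_j$; $(+,\oplus)$ from $\Gamma,\sum_{j\in I\cup J}a_j.\sigma_j\dashv\bigoplus_{i\in I}\overline a_i.\rho_i\rhd\sigma_i\dashv\rho_i$ ($\forall i\in I$) infer $\Gamma\rhd\sum_{j\in I\cup J}a_j.\sigma_j\dashv\bigoplus_{i\in I}\overline a_i.\rho_i$. Derivations are finite trees; contracts are taken modulo recursion fold/unfold. -}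

module Defs where

open import Data.Nat using (ℕ; zero; suc; _≤_)
open import Data.Fin using (Fin; zero; suc)
open import Data.List using (List; []; _∷_; map; length)
open import Data.List.Relation.Unary.All using (All)
open import Data.List.Relation.Unary.Any as Any using (Any; _─_)
open import Data.List.Membership.Propositional using (_∈_)
open import Data.List.Relation.Unary.Unique.Propositional using (Unique)
open import Data.Maybe using (Maybe; just; nothing)
open import Data.Product using (Σ; _×_; _,_; proj₁; proj₂; ∃)
open import Data.Sum using (_⊎_)
open import Data.Empty using (⊥)
open import Data.Unit using (⊤)
open import Relation.Nullary using (¬_)
open import Relation.Binary.PropositionalEquality using (_≡_; _≢_)
open import Relation.Binary.Construct.Closure.ReflexiveTransitive using (Star)

Name : Set
Name = ℕ

-- Kinds of choices:
--   In   : external sum of names      Σ a_i.σ_i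
--   OutE : external sum of conames    Σ ā_i.σ_i
--   OutI : internal choice of conames ⊕ ā_i.σ_i
data Kind : Set where
  In OutE OutI : Kind

data Con (n : ℕ) : Set where
  one : Con n
  sum : Kind → List (Name × Con n) → Con n
  var : Fin n → Con n
  rec : Con (suc n) → Con n

mutual
  WF : ∀ {n} → Con n → Set
  WF one = ⊤
  WF (sum κ bs) = bs ≢ [] × Unique (map proj₁ bs) × WFs bs
  WF (var x) = ⊤
  WF (rec (var x)) = ⊥
  WF (rec σ@one) = WF σ
  WF (rec σ@(sum _ _)) = WF σ
  WF (rec σ@(rec _)) = WF σ

  WFs : ∀ {n} → List (Name × Con n) → Set
  WFs [] = ⊤
  WFs ((a , σ) ∷ bs) = WF σ × WFs bs

-- Retractable contracts: closed well-formed terms.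
Contract : Set
Contract = Con 0

ext : ∀ {n m} → (Fin n → Fin m) → Fin (suc n) → Fin (suc m)
ext f zero = zero
ext f (suc i) = suc (f i)

mutual
  rename : ∀ {n m} → (Fin n → Fin m) → Con n → Con m
  rename f one = one
  rename f (sum κ bs) = sum κ (renameBs f bs)
  rename f (var x) = var (f x)
  rename f (rec σ) = rec (rename (ext f) σ)

  renameBs : ∀ {n m} → (Fin n → Fin m) → List (Name × Con n) → List (Name × Con m)
  renameBs f [] = []
  renameBs f ((a , σ) ∷ bs) = (a , rename f σ) ∷ renameBs f bs

exts : ∀ {n m} → (Fin n → Con m) → Fin (suc n) → Con (suc m)
exts s zero = var zero
exts s (suc i) = rename suc (s i)

mutual
  subst : ∀ {n m} → (Fin n → Con m) → Con n → Con m
  subst s one = one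
  subst s (sum κ bs) = sum κ (substBs s bs)
  subst s (var x) = s x
  subst s (rec σ) = rec (subst (exts s) σ)

  substBs : ∀ {n m} → (Fin n → Con m) → List (Name × Con n) → List (Name × Con m)
  substBs s [] = []
  substBs s ((a , σ) ∷ bs) = (a , subst s σ) ∷ substBs s bs

unfold : Con 1 → Contract
unfold σ = subst (λ _ → rec σ) σ

NotRec : Contract → Set
NotRec (rec _) = ⊥
NotRec _ = ⊤

data Unf : Contract → Contract → Set where
  done : ∀ {σ} → NotRec σ → Unf σ σ
  step : ∀ {σ τ} → Unf (unfold σ) τ → Unf (rec σ) τ

IsOne : Contract → Set
IsOne ρ = Unf ρ one

-- Equality of contracts modulo fold/unfold, commutativity of choices,
-- and identification of unary outputs: equality of the (regular) trees,
-- i.e. agreement of all finite-depth truncations.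

data SameKind {A : Set} : Kind → List A → Kind → List A → Set where
  same    : ∀ {κ bs cs} → SameKind κ bs κ cs
  unaryEI : ∀ {b c} → SameKind OutE (b ∷ []) OutI (c ∷ [])
  unaryIE : ∀ {b c} → SameKind OutI (b ∷ []) OutE (c ∷ [])

data _≈⟨_⟩_ : Contract → ℕ → Contract → Set where
  ≈zero : ∀ {σ τ} → σ ≈⟨ zero ⟩ τ
  ≈one  : ∀ {σ τ k} → Unf σ one → Unf τ one → σ ≈⟨ suc k ⟩ τ
  ≈sum  : ∀ {σ τ k κ κ' bs cs} → Unf σ (sum κ bs) → Unf τ (sum κ' cs) →
          SameKind κ bs κ' cs →
          All (λ b → Any (λ c → proj₁ b ≡ proj₁ c × proj₂ b ≈⟨ k ⟩ proj₂ c) cs) bs →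
          All (λ c → Any (λ b → proj₁ b ≡ proj₁ c × proj₂ b ≈⟨ k ⟩ proj₂ c) bs) cs →
          σ ≈⟨ suc k ⟩ τ

infix 4 _≈_
_≈_ : Contract → Contract → Set
σ ≈ τ = ∀ k → σ ≈⟨ k ⟩ τ

data Act : Set where
  inp : Name → Act
  out : Name → Act

dual : Act → Act
dual (inp a) = out a
dual (out a) = inp a

lab : Kind → Name → Act
lab In a = inp a
lab OutE a = out a
lab OutI a = out a

data Label : Set where
  act : Act → Label
  τ   : Label
  rb  : Label

-- History: top element is the head of the list; nothing stands for ∘.
History : Set
History = List (Maybe Contract)

Conf : Set
Conf = History × Contract

External : Kind → Set
External In = ⊤
External OutE = ⊤
External OutI = ⊥

data _─[_]→_ : Conf → Label → Conf → Set where
  -- ⟨γ⟩(α.σ + σ') -α→ ⟨γ:σ'⟩σ   (σ' a non-empty sum of the remaining branches)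
  ext-sum : ∀ {γ ρ κ bs a ρ₁} → Unf ρ (sum κ bs) → External κ → 2 ≤ length bs →
            (p : (a , ρ₁) ∈ bs) →
            (γ , ρ) ─[ act (lab κ a) ]→ (just (sum κ (bs ─ p)) ∷ γ , ρ₁)
  int-tau : ∀ {γ ρ bs a ρ₁} → Unf ρ (sum OutI bs) → 2 ≤ length bs →
            (a , ρ₁) ∈ bs →
            (γ , ρ) ─[ τ ]→ (γ , sum OutE ((a , ρ₁) ∷ []))
  prefix  : ∀ {γ ρ κ a ρ₁} → Unf ρ (sum κ ((a , ρ₁) ∷ [])) →
            (γ , ρ) ─[ act (lab κ a) ]→ (nothing ∷ γ , ρ₁)
  rollback : ∀ {γ σ σ'} → (just σ' ∷ γ , σ) ─[ rb ]→ (γ , σ')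

Pair : Set
Pair = Conf × Conf

data _⟶ct_ : Pair → Pair → Set where
  comm : ∀ {c c' s s' α} → c ─[ act α ]→ c' → s ─[ act (dual α) ]→ s' → (c , s) ⟶ct (c' , s')
  τl   : ∀ {c c' s} → c ─[ τ ]→ c' → (c , s) ⟶ct (c' , s)
  τr   : ∀ {c s s'} → s ─[ τ ]→ s' → (c , s) ⟶ct (c , s')

data _⟶_ : Pair → Pair → Set where
  ct  : ∀ {p q} → p ⟶ct q → p ⟶ q
  rbk : ∀ {c c' s s'} → ¬ IsOne (proj₂ c) → c ─[ rb ]→ c' → s ─[ rb ]→ s' →
        ¬ (∃ λ q → (c , s) ⟶ct q) → (c , s) ⟶ (c' , s')

_⟶*_ : Pair → Pair → Set
_⟶*_ = Star _⟶_

Compliant : Contract → Contract → Set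
Compliant ρ σ = ∀ c s → (([] , ρ) , ([] , σ)) ⟶* (c , s) →
                ¬ (∃ λ q → (c , s) ⟶ q) → IsOne (proj₂ c)

-- ρ is (modulo unfolding) an external choice α.ρ₁ + ρ' (ρ' possibly absent);
-- a unary internal choice counts as a unary output prefix.
data ExtBr : Contract → Act → Contract → Set where
  extBr : ∀ {ρ κ bs a ρ₁} → Unf ρ (sum κ bs) → External κ → (a , ρ₁) ∈ bs →
          ExtBr ρ (lab κ a) ρ₁
  unaryI : ∀ {ρ a ρ₁} → Unf ρ (sum OutI ((a , ρ₁) ∷ [])) → ExtBr ρ (out a) ρ₁

-- ρ is (modulo unfolding) an internal choice ⊕_{i∈I} ā_i.ρ_i
-- (a unary external output counts as a unary internal choice).
data IntCh : Contract → List (Name × Contract) → Set where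
  intCh  : ∀ {ρ bs} → Unf ρ (sum OutI bs) → IntCh ρ bs
  unaryE : ∀ {ρ b} → Unf ρ (sum OutE (b ∷ [])) → IntCh ρ (b ∷ [])

Ctx : Set
Ctx = List (Contract × Contract)

infix 3 _⊳_⊣_
data _⊳_⊣_ (Γ : Ctx) : Contract → Contract → Set where
  Ax  : ∀ {ρ σ} → IsOne ρ → Γ ⊳ ρ ⊣ σ
  Hyp : ∀ {ρ σ} → Any (λ h → proj₁ h ≈ ρ × proj₂ h ≈ σ) Γ → Γ ⊳ ρ ⊣ σ
  ++  : ∀ {ρ σ α ρ₁ σ₁} → ExtBr ρ α ρ₁ → ExtBr σ (dual α) σ₁ →
        ((ρ , σ) ∷ Γ) ⊳ ρ₁ ⊣ σ₁ → Γ ⊳ ρ ⊣ σ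
  ⊕+  : ∀ {ρ σ bs cs} → IntCh ρ bs → Unf σ (sum In cs) →
        All (λ b → Any (λ c → proj₁ c ≡ proj₁ b × ((ρ , σ) ∷ Γ) ⊳ proj₂ b ⊣ proj₂ c) cs) bs →
        Γ ⊳ ρ ⊣ σ
  +⊕  : ∀ {ρ σ bs cs} → Unf ρ (sum In cs) → IntCh σ bs →
        All (λ b → Any (λ c → proj₁ c ≡ proj₁ b × ((ρ , σ) ∷ Γ) ⊳ proj₂ c ⊣ proj₂ b) cs) bs →
        Γ ⊳ ρ ⊣ σ

-- The contracts reachable from ρ and σ by unfolding and choosing branches form finite sets,
-- the closed instances of their subterms. A search over pairs of reachable contracts, which
-- records the visited pairs as hypotheses, produces for every pair either a derivation or a
-- run of client and server that gets stuck with the client different from 1; it terminates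
-- because every recursive call visits a new pair. Such a run contradicts compliance. The only
-- case needing rollbacks is an external choice facing an external choice whose matching
-- branches all fail: the pair synchronises on one of them and, when that run fails, rolls back
-- to the residual choices, so the failure propagates by induction on the number of branches.

module Submission where

open import Defs
open import Data.Nat as ℕ using (ℕ; zero; suc; _≤_; _<_; z≤n; s≤s)
open import Data.Nat.Properties using (m≤n⇒m≤1+n; m<n⇒m<1+n; <⇒≱; ≤-reflexive)
open import Data.Nat.Induction using (<-wellFounded)
open import Induction.WellFounded using (Acc; acc)
open import Data.Fin as Fin using (Fin; zero; suc)
open import Data.List as List using (List; []; _∷_; length; cartesianProduct)
open import Data.List.Relation.Unary.All as All using (All; []; _∷_)
open import Data.List.Relation.Unary.Any as Any using (Any; here; there; _─_)
open import Data.List.Relation.Unary.Any.Properties using (++⁺ˡ; ++⁺ʳ; ++⁻)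
open import Data.List.Relation.Unary.All.Properties using (─⁺)
open import Data.List.Properties using (length-removeAt′)
open import Data.List.Membership.Propositional using (_∈_; _∉_; find; lose)
open import Data.List.Membership.Propositional.Properties using (∈-cartesianProduct⁺)
open import Data.List.Relation.Binary.Subset.Propositional using (_⊆_)
open import Data.Product using (Σ; _×_; _,_; proj₁; proj₂; ∃)
open import Data.Product.Properties using () renaming (≡-dec to ×-≡-dec)
open import Data.Sum as Sum using (_⊎_; inj₁; inj₂)
open import Data.Empty using (⊥; ⊥-elim)
open import Data.Unit using (⊤; tt)
open import Data.Bool using (Bool; true; false)
open import Data.Maybe using (Maybe; just; nothing)
open import Function using (_∘_; id)
open import Relation.Nullary using (¬_; yes; no; contradiction)
open import Relation.Nullary.Decidable using (map′; _×-dec_)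
open import Relation.Binary.Definitions using (DecidableEquality)
open import Relation.Binary.PropositionalEquality as Eq
  using (_≡_; _≢_; refl; sym; trans; cong; cong₂; _≗_)
open import Relation.Binary.Construct.Closure.ReflexiveTransitive
  using (Star; ε; _◅_; _◅◅_; gmap)

ext-cong : ∀ {n m} {f g : Fin n → Fin m} → f ≗ g → ext f ≗ ext g
ext-cong f≗g zero = refl
ext-cong f≗g (suc i) = cong suc (f≗g i)

mutual
  rename-cong : ∀ {n m} {f g : Fin n → Fin m} → f ≗ g → rename f ≗ rename g
  rename-cong f≗g one = refl
  rename-cong f≗g (sum κ bs) = cong (sum κ) (renameBs-cong f≗g bs)
  rename-cong f≗g (var x) = cong var (f≗g x)
  rename-cong f≗g (rec t) = cong rec (rename-cong (ext-cong f≗g) t)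

  renameBs-cong : ∀ {n m} {f g : Fin n → Fin m} → f ≗ g → renameBs f ≗ renameBs g
  renameBs-cong f≗g [] = refl
  renameBs-cong f≗g ((a , t) ∷ bs) =
    cong₂ (λ u v → (a , u) ∷ v) (rename-cong f≗g t) (renameBs-cong f≗g bs)

exts-cong : ∀ {n m} {f g : Fin n → Con m} → f ≗ g → exts f ≗ exts g
exts-cong f≗g zero = refl
exts-cong f≗g (suc i) = cong (rename suc) (f≗g i)

mutual
  subst-cong : ∀ {n m} {f g : Fin n → Con m} → f ≗ g → subst f ≗ subst g
  subst-cong f≗g one = refl
  subst-cong f≗g (sum κ bs) = cong (sum κ) (substBs-cong f≗g bs)
  subst-cong f≗g (var x) = f≗g x
  subst-cong f≗g (rec t) = cong rec (subst-cong (exts-cong f≗g) t)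

  substBs-cong : ∀ {n m} {f g : Fin n → Con m} → f ≗ g → substBs f ≗ substBs g
  substBs-cong f≗g [] = refl
  substBs-cong f≗g ((a , t) ∷ bs) =
    cong₂ (λ u v → (a , u) ∷ v) (subst-cong f≗g t) (substBs-cong f≗g bs)

ext-∘ : ∀ {n m k} (f : Fin m → Fin k) (g : Fin n → Fin m) → ext f ∘ ext g ≗ ext (f ∘ g)
ext-∘ f g zero = refl
ext-∘ f g (suc i) = refl

mutual
  rename-rename : ∀ {n m k} (f : Fin m → Fin k) (g : Fin n → Fin m) t →
                  rename f (rename g t) ≡ rename (f ∘ g) t
  rename-rename f g one = refl
  rename-rename f g (sum κ bs) = cong (sum κ) (renameBs-renameBs f g bs)
  rename-rename f g (var x) = refl
  rename-rename f g (rec t) =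
    cong rec (trans (rename-rename (ext f) (ext g) t) (rename-cong (ext-∘ f g) t))

  renameBs-renameBs : ∀ {n m k} (f : Fin m → Fin k) (g : Fin n → Fin m) bs →
                      renameBs f (renameBs g bs) ≡ renameBs (f ∘ g) bs
  renameBs-renameBs f g [] = refl
  renameBs-renameBs f g ((a , t) ∷ bs) =
    cong₂ (λ u v → (a , u) ∷ v) (rename-rename f g t) (renameBs-renameBs f g bs)

exts-ext : ∀ {n m k} (s : Fin m → Con k) (f : Fin n → Fin m) → exts s ∘ ext f ≗ exts (s ∘ f)
exts-ext s f zero = refl
exts-ext s f (suc i) = refl

mutual
  subst-rename : ∀ {n m k} (s : Fin m → Con k) (f : Fin n → Fin m) t →
                 subst s (rename f t) ≡ subst (s ∘ f) t
  subst-rename s f one = refl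
  subst-rename s f (sum κ bs) = cong (sum κ) (substBs-renameBs s f bs)
  subst-rename s f (var x) = refl
  subst-rename s f (rec t) =
    cong rec (trans (subst-rename (exts s) (ext f) t) (subst-cong (exts-ext s f) t))

  substBs-renameBs : ∀ {n m k} (s : Fin m → Con k) (f : Fin n → Fin m) bs →
                     substBs s (renameBs f bs) ≡ substBs (s ∘ f) bs
  substBs-renameBs s f [] = refl
  substBs-renameBs s f ((a , t) ∷ bs) =
    cong₂ (λ u v → (a , u) ∷ v) (subst-rename s f t) (substBs-renameBs s f bs)

mutual
  rename-subst : ∀ {n m k} (f : Fin m → Fin k) (s : Fin n → Con m) t →
                 rename f (subst s t) ≡ subst (rename f ∘ s) t
  rename-subst f s one = refl
  rename-subst f s (sum κ bs) = cong (sum κ) (renameBs-substBs f s bs)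
  rename-subst f s (var x) = refl
  rename-subst f s (rec t) =
    cong rec (trans (rename-subst (ext f) (exts s) t) (subst-cong ext-exts t))
    where
    ext-exts : rename (ext f) ∘ exts s ≗ exts (rename f ∘ s)
    ext-exts zero = refl
    ext-exts (suc i) = trans (rename-rename (ext f) suc (s i)) (sym (rename-rename suc f (s i)))

  renameBs-substBs : ∀ {n m k} (f : Fin m → Fin k) (s : Fin n → Con m) bs →
                     renameBs f (substBs s bs) ≡ substBs (rename f ∘ s) bs
  renameBs-substBs f s [] = refl
  renameBs-substBs f s ((a , t) ∷ bs) =
    cong₂ (λ u v → (a , u) ∷ v) (rename-subst f s t) (renameBs-substBs f s bs)

mutual
  subst-subst : ∀ {n m k} (s : Fin m → Con k) (r : Fin n → Con m) t →
                subst s (subst r t) ≡ subst (subst s ∘ r) t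
  subst-subst s r one = refl
  subst-subst s r (sum κ bs) = cong (sum κ) (substBs-substBs s r bs)
  subst-subst s r (var x) = refl
  subst-subst s r (rec t) =
    cong rec (trans (subst-subst (exts s) (exts r) t) (subst-cong exts-exts t))
    where
    exts-exts : subst (exts s) ∘ exts r ≗ exts (subst s ∘ r)
    exts-exts zero = refl
    exts-exts (suc i) = trans (subst-rename (exts s) suc (r i)) (sym (rename-subst suc s (r i)))

  substBs-substBs : ∀ {n m k} (s : Fin m → Con k) (r : Fin n → Con m) bs →
                    substBs s (substBs r bs) ≡ substBs (subst s ∘ r) bs
  substBs-substBs s r [] = refl
  substBs-substBs s r ((a , t) ∷ bs) =
    cong₂ (λ u v → (a , u) ∷ v) (subst-subst s r t) (substBs-substBs s r bs)

exts-var : ∀ {n} → exts (var {n}) ≗ var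
exts-var zero = refl
exts-var (suc i) = refl

mutual
  subst-var : ∀ {n} (t : Con n) → subst var t ≡ t
  subst-var one = refl
  subst-var (sum κ bs) = cong (sum κ) (substBs-var bs)
  subst-var (var x) = refl
  subst-var (rec t) = cong rec (trans (subst-cong exts-var t) (subst-var t))

  substBs-var : ∀ {n} (bs : List (Name × Con n)) → substBs var bs ≡ bs
  substBs-var [] = refl
  substBs-var ((a , t) ∷ bs) = cong₂ (λ u v → (a , u) ∷ v) (subst-var t) (substBs-var bs)

subst-closed : (s : Fin 0 → Contract) (t : Contract) → subst s t ≡ t
subst-closed s t = trans (subst-cong (λ ()) t) (subst-var t)

Env : ℕ → Set
Env n = Fin n → Contract

_▸_ : ∀ {n} → Env n → Contract → Env (suc n)
(e ▸ r) zero = r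
(e ▸ r) (suc i) = e i

unfold-subst : ∀ {n} (e : Env n) (σ : Con (suc n)) →
               unfold (subst (exts e) σ) ≡ subst (e ▸ subst e (rec σ)) σ
unfold-subst e σ = trans (subst-subst _ (exts e) σ) (subst-cong closing σ)
  where
  closing : subst (λ _ → subst e (rec σ)) ∘ exts e ≗ e ▸ subst e (rec σ)
  closing zero = refl
  closing (suc i) = trans (subst-rename _ suc (e i)) (subst-closed _ (e i))

-- Finitely many reachable contracts

NotVar : ∀ {n} → Con n → Set
NotVar (var _) = ⊥
NotVar _ = ⊤

mutual
  Contractive : ∀ {n} → Con n → Set
  Contractive one = ⊤
  Contractive (sum κ bs) = Contractives bs
  Contractive (var x) = ⊤
  Contractive (rec σ) = NotVar σ × Contractive σ

  Contractives : ∀ {n} → List (Name × Con n) → Set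
  Contractives [] = ⊤
  Contractives ((a , σ) ∷ bs) = Contractive σ × Contractives bs

mutual
  WF⇒Contractive : ∀ {n} (t : Con n) → WF t → Contractive t
  WF⇒Contractive one _ = tt
  WF⇒Contractive (sum κ bs) (_ , _ , wf) = WFs⇒Contractives bs wf
  WF⇒Contractive (var x) _ = tt
  WF⇒Contractive (rec one) _ = tt , tt
  WF⇒Contractive (rec (sum κ bs)) wf = tt , WF⇒Contractive (sum κ bs) wf
  WF⇒Contractive (rec (rec σ)) wf = tt , WF⇒Contractive (rec σ) wf

  WFs⇒Contractives : ∀ {n} (bs : List (Name × Con n)) → WFs bs → Contractives bs
  WFs⇒Contractives [] _ = tt
  WFs⇒Contractives ((a , σ) ∷ bs) (wf , wfs) = WF⇒Contractive σ wf , WFs⇒Contractives bs wfs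

data IsHead : Contract → Set where
  one : IsHead one
  sum : ∀ κ bs → IsHead (sum κ bs)

HasHead : Contract → Set
HasHead u = Σ Contract λ h → Unf u h × IsHead h

instance-hasHead : ∀ {n} (t : Con n) (e : Env n) → Contractive t → NotVar t → HasHead (subst e t)
instance-hasHead one e _ _ = one , done tt , one
instance-hasHead (sum κ bs) e _ _ = _ , done tt , sum _ _
instance-hasHead (rec σ) e (σ-nv , σ-c) _ =
  let h , u , h-head = instance-hasHead σ (e ▸ subst e (rec σ)) σ-c σ-nv
  in h , step (Eq.subst (λ z → Unf z h) (sym (unfold-subst e σ)) u) , h-head

-- The closed instances of the non-variable subterms of t, each bound variable being
-- instantiated by the rec-term that binds it: a finite set closed under unfolding and branching.
mutual
  closedSubterms : ∀ {n} → Con n → Env n → List Contract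
  closedSubterms (var x) e = []
  closedSubterms one e = one ∷ []
  closedSubterms (sum κ bs) e = subst e (sum κ bs) ∷ closedSubtermsBs bs e
  closedSubterms (rec σ) e = subst e (rec σ) ∷ closedSubterms σ (e ▸ subst e (rec σ))

  closedSubtermsBs : ∀ {n} → List (Name × Con n) → Env n → List Contract
  closedSubtermsBs [] e = []
  closedSubtermsBs ((a , t) ∷ bs) e = closedSubterms t e List.++ closedSubtermsBs bs e

mutual
  closedSubterms-hasHead : ∀ {n} (t : Con n) e → Contractive t →
                           ∀ {u} → u ∈ closedSubterms t e → HasHead u
  closedSubterms-hasHead one e c (here refl) = instance-hasHead one e c tt
  closedSubterms-hasHead (sum κ bs) e c (here refl) = instance-hasHead (sum κ bs) e c tt
  closedSubterms-hasHead (sum κ bs) e c (there p) = closedSubtermsBs-hasHead bs e c p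
  closedSubterms-hasHead (rec σ) e c (here refl) = instance-hasHead (rec σ) e c tt
  closedSubterms-hasHead (rec σ) e (_ , c) (there p) = closedSubterms-hasHead σ _ c p

  closedSubtermsBs-hasHead : ∀ {n} (bs : List (Name × Con n)) e → Contractives bs →
                             ∀ {u} → u ∈ closedSubtermsBs bs e → HasHead u
  closedSubtermsBs-hasHead ((a , t) ∷ bs) e (c , cs) p with ++⁻ (closedSubterms t e) p
  ... | inj₁ q = closedSubterms-hasHead t e c q
  ... | inj₂ q = closedSubtermsBs-hasHead bs e cs q

SuccessorsIn : List Contract → Contract → Set
SuccessorsIn G (rec σ) = unfold σ ∈ G
SuccessorsIn G (sum κ bs) = ∀ {a x} → (a , x) ∈ bs → x ∈ G
SuccessorsIn G _ = ⊤

module _ (G : List Contract) where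

  EnvIn : ∀ {n} → Env n → Set
  EnvIn e = ∀ i → e i ∈ G

  _▸∈_ : ∀ {n} {e : Env n} {r} → EnvIn e → r ∈ G → EnvIn (e ▸ r)
  (e∈ ▸∈ r∈) zero = r∈
  (e∈ ▸∈ r∈) (suc i) = e∈ i

  instance-∈ : ∀ {n} (t : Con n) e → EnvIn e → closedSubterms t e ⊆ G → subst e t ∈ G
  instance-∈ (var i) e e∈ _ = e∈ i
  instance-∈ one e _ sub = sub (here refl)
  instance-∈ (sum κ bs) e _ sub = sub (here refl)
  instance-∈ (rec σ) e _ sub = sub (here refl)

  branches-∈ : ∀ {n} (bs : List (Name × Con n)) e → EnvIn e → closedSubtermsBs bs e ⊆ G →
               ∀ {a x} → (a , x) ∈ substBs e bs → x ∈ G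
  branches-∈ ((b , t) ∷ bs) e e∈ sub (here refl) = instance-∈ t e e∈ (sub ∘ ++⁺ˡ)
  branches-∈ ((b , t) ∷ bs) e e∈ sub (there p) =
    branches-∈ bs e e∈ (sub ∘ ++⁺ʳ (closedSubterms t e)) p

  mutual
    closedSubterms-successors : ∀ {n} (t : Con n) e → EnvIn e → closedSubterms t e ⊆ G →
                                ∀ {u} → u ∈ closedSubterms t e → SuccessorsIn G u
    closedSubterms-successors one e e∈ sub (here refl) = tt
    closedSubterms-successors (sum κ bs) e e∈ sub (here refl) = branches-∈ bs e e∈ (sub ∘ there)
    closedSubterms-successors (sum κ bs) e e∈ sub (there p) =
      closedSubtermsBs-successors bs e e∈ (sub ∘ there) p
    closedSubterms-successors (rec σ) e e∈ sub (here refl) =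
      Eq.subst (_∈ G) (sym (unfold-subst e σ))
               (instance-∈ σ _ (e∈ ▸∈ sub (here refl)) (sub ∘ there))
    closedSubterms-successors (rec σ) e e∈ sub (there p) =
      closedSubterms-successors σ _ (e∈ ▸∈ sub (here refl)) (sub ∘ there) p

    closedSubtermsBs-successors : ∀ {n} (bs : List (Name × Con n)) e → EnvIn e →
                                  closedSubtermsBs bs e ⊆ G →
                                  ∀ {u} → u ∈ closedSubtermsBs bs e → SuccessorsIn G u
    closedSubtermsBs-successors ((a , t) ∷ bs) e e∈ sub p with ++⁻ (closedSubterms t e) p
    ... | inj₁ q = closedSubterms-successors t e e∈ (sub ∘ ++⁺ˡ) q
    ... | inj₂ q = closedSubtermsBs-successors bs e e∈ (sub ∘ ++⁺ʳ (closedSubterms t e)) q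

record Closed (G : List Contract) : Set where
  field
    hasHead    : ∀ {u} → u ∈ G → HasHead u
    successors : ∀ {u} → u ∈ G → SuccessorsIn G u

states : Contract → List Contract
states t = closedSubterms t λ ()

states-closed : (t : Contract) → Contractive t → Closed (states t)
states-closed t c = record
  { hasHead = closedSubterms-hasHead t _ c
  ; successors = closedSubterms-successors (states t) t _ (λ ()) id
  }

∈-states : (t : Contract) → t ∈ states t
∈-states t = Eq.subst (_∈ states t) (subst-closed _ t) (instance-∈ (states t) t _ (λ ()) id)

module Closed-∈ {G : List Contract} (closed : Closed G) where
  open Closed closed

  unf-∈ : ∀ {u h} → u ∈ G → Unf u h → h ∈ G
  unf-∈ u∈ (done _) = u∈
  unf-∈ u∈ (step uf) = unf-∈ (successors u∈) uf

  branch-∈ : ∀ {κ bs a x} → sum κ bs ∈ G → (a , x) ∈ bs → x ∈ G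
  branch-∈ h∈ = successors h∈

  -- Not every raw contract is ≈ to itself: rec x. x has no head.
  ≈-refl : ∀ {u} → u ∈ G → u ≈ u
  ≈-refl u∈ zero = ≈zero
  ≈-refl u∈ (suc k) with hasHead u∈
  ... | _ , uf , one = ≈one uf uf
  ... | _ , uf , sum κ bs =
    ≈sum uf uf same (All.tabulate λ b∈ → Any.map (λ { refl → refl , ≈-branch b∈ }) b∈)
                    (All.tabulate λ c∈ → Any.map (λ { refl → refl , ≈-branch c∈ }) c∈)
    where
    ≈-branch : ∀ {b} → b ∈ bs → proj₂ b ≈⟨ k ⟩ proj₂ b
    ≈-branch b∈ = ≈-refl (branch-∈ (unf-∈ u∈ uf) b∈) k

-- Decidable equality and the termination measure

_≟ᴷ_ : DecidableEquality Kind
In ≟ᴷ In = yes refl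
In ≟ᴷ OutE = no λ ()
In ≟ᴷ OutI = no λ ()
OutE ≟ᴷ In = no λ ()
OutE ≟ᴷ OutE = yes refl
OutE ≟ᴷ OutI = no λ ()
OutI ≟ᴷ In = no λ ()
OutI ≟ᴷ OutE = no λ ()
OutI ≟ᴷ OutI = yes refl

mutual
  _≟ᶜ_ : ∀ {n} → DecidableEquality (Con n)
  one ≟ᶜ one = yes refl
  sum κ bs ≟ᶜ sum κ′ cs =
    map′ (λ { (refl , refl) → refl }) (λ { refl → refl , refl }) (κ ≟ᴷ κ′ ×-dec bs ≟ᵇ cs)
  var i ≟ᶜ var j = map′ (cong var) (λ { refl → refl }) (i Fin.≟ j)
  rec s ≟ᶜ rec t = map′ (cong rec) (λ { refl → refl }) (s ≟ᶜ t)
  one ≟ᶜ sum _ _ = no λ ()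
  one ≟ᶜ var _ = no λ ()
  one ≟ᶜ rec _ = no λ ()
  sum _ _ ≟ᶜ one = no λ ()
  sum _ _ ≟ᶜ var _ = no λ ()
  sum _ _ ≟ᶜ rec _ = no λ ()
  var _ ≟ᶜ one = no λ ()
  var _ ≟ᶜ sum _ _ = no λ ()
  var _ ≟ᶜ rec _ = no λ ()
  rec _ ≟ᶜ one = no λ ()
  rec _ ≟ᶜ sum _ _ = no λ ()
  rec _ ≟ᶜ var _ = no λ ()

  _≟ᵇ_ : ∀ {n} → DecidableEquality (List (Name × Con n))
  [] ≟ᵇ [] = yes refl
  [] ≟ᵇ (_ ∷ _) = no λ ()
  (_ ∷ _) ≟ᵇ [] = no λ ()
  ((a , s) ∷ bs) ≟ᵇ ((c , t) ∷ cs) =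
    map′ (λ { (refl , refl , refl) → refl }) (λ { refl → refl , refl , refl })
         (a ℕ.≟ c ×-dec s ≟ᶜ t ×-dec bs ≟ᵇ cs)

_≟ᵖ_ : DecidableEquality (Contract × Contract)
_≟ᵖ_ = ×-≡-dec _≟ᶜ_ _≟ᶜ_

module Unvisited {A : Set} (_≟_ : DecidableEquality A) where
  open import Data.List.Membership.DecPropositional _≟_ using (_∈?_)

  unvisited : List A → List A → ℕ
  unvisited Γ [] = 0
  unvisited Γ (p ∷ L) with p ∈? Γ
  ... | yes _ = unvisited Γ L
  ... | no _ = suc (unvisited Γ L)

  -- p ∈? q ∷ Γ is computed from p ≟ q and p ∈? Γ, so the proofs split on these two.
  unvisited-mono : ∀ q Γ L → unvisited (q ∷ Γ) L ≤ unvisited Γ L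
  unvisited-mono q Γ [] = z≤n
  unvisited-mono q Γ (p ∷ L) with p ≟ q | p ∈? Γ
  ... | yes _ | yes _ = unvisited-mono q Γ L
  ... | no _ | yes _ = unvisited-mono q Γ L
  ... | yes _ | no _ = m≤n⇒m≤1+n (unvisited-mono q Γ L)
  ... | no _ | no _ = s≤s (unvisited-mono q Γ L)

  unvisited-visit : ∀ {q} Γ L → q ∈ L → q ∉ Γ → unvisited (q ∷ Γ) L < unvisited Γ L
  unvisited-visit {q} Γ (q ∷ L) (here refl) q∉ with q ≟ q | q ∈? Γ
  ... | yes _ | yes q∈ = contradiction q∈ q∉
  ... | yes _ | no _ = s≤s (unvisited-mono q Γ L)
  ... | no q≢q | _ = contradiction refl q≢q
  unvisited-visit {q} Γ (p ∷ L) (there q∈L) q∉ with p ≟ q | p ∈? Γ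
  ... | yes _ | yes _ = unvisited-visit Γ L q∈L q∉
  ... | no _ | yes _ = unvisited-visit Γ L q∈L q∉
  ... | yes _ | no _ = m<n⇒m<1+n (unvisited-visit Γ L q∈L q∉)
  ... | no _ | no _ = s≤s (unvisited-visit Γ L q∈L q∉)

all⊎any : ∀ {A : Set} {P Q : A → Set} {xs} → (∀ {x} → x ∈ xs → P x ⊎ Q x) → All P xs ⊎ Any Q xs
all⊎any {xs = []} _ = inj₁ []
all⊎any {xs = x ∷ xs} f with f (here refl) | all⊎any (f ∘ there)
... | inj₂ q | _ = inj₂ (here q)
... | inj₁ p | inj₁ ps = inj₁ (p ∷ ps)
... | inj₁ _ | inj₂ qs = inj₂ (there qs)

any⊎all : ∀ {A : Set} {P Q : A → Set} {xs} → (∀ {x} → x ∈ xs → P x ⊎ Q x) → Any P xs ⊎ All Q xs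
any⊎all f = Sum.swap (all⊎any (Sum.swap ∘ f))

residual-shorter : ∀ {A : Set} {xs : List A} {x} (x∈ : x ∈ xs) → length (xs ─ x∈) < length xs
residual-shorter {xs = xs} x∈ = ≤-reflexive (sym (length-removeAt′ xs (Any.index x∈)))

module _ {A : Set} where

  Branches : Set
  Branches = List (Name × A)

  AnyMatching : (A → A → Set) → Branches → Branches → Set
  AnyMatching R bs cs = Any (λ b → Any (λ c → proj₁ c ≡ proj₁ b × R (proj₂ b) (proj₂ c)) cs) bs

  AllMatching : (A → A → Set) → Branches → Branches → Set
  AllMatching R bs cs = All (λ b → All (λ c → proj₁ c ≡ proj₁ b → R (proj₂ b) (proj₂ c)) cs) bs

  Covered : (A → A → Set) → Branches → Branches → Set
  Covered R bs cs = All (λ b → Any (λ c → proj₁ c ≡ proj₁ b × R (proj₂ b) (proj₂ c)) cs) bs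

  find-matching : ∀ {R bs cs} → AnyMatching R bs cs →
                  Σ Name λ a → Σ A λ x → Σ A λ y → (a , x) ∈ bs × (a , y) ∈ cs × R x y
  find-matching m with find m
  ... | (a , x) , b∈ , m′ with find m′
  ...   | (_ , y) , c∈ , refl , r = a , x , y , b∈ , c∈ , r

  module _ {R S : A → A → Set} {bs cs : Branches}
           (R⊎S : ∀ {b c} → b ∈ bs → c ∈ cs → R (proj₂ b) (proj₂ c) ⊎ S (proj₂ b) (proj₂ c))
           where

    private
      match : ∀ {b c} → b ∈ bs → c ∈ cs →
              (proj₁ c ≡ proj₁ b × R (proj₂ b) (proj₂ c)) ⊎
              (proj₁ c ≡ proj₁ b → S (proj₂ b) (proj₂ c))
      match {b} {c} b∈ c∈ with proj₁ c ℕ.≟ proj₁ b | R⊎S b∈ c∈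
      ... | yes eq | inj₁ r = inj₁ (eq , r)
      ... | yes _ | inj₂ s = inj₂ λ _ → s
      ... | no neq | _ = inj₂ λ eq → contradiction eq neq

    anyMatching⊎allMatching : AnyMatching R bs cs ⊎ AllMatching S bs cs
    anyMatching⊎allMatching = any⊎all λ b∈ → any⊎all (match b∈)

    covered⊎uncovered :
      Covered R bs cs ⊎ Any (λ b → All (λ c → proj₁ c ≡ proj₁ b → S (proj₂ b) (proj₂ c)) cs) bs
    covered⊎uncovered = all⊎any λ b∈ → any⊎all (match b∈)

unf-det : ∀ {u h h′} → Unf u h → Unf u h′ → h ≡ h′
unf-det (done _) (done _) = refl
unf-det (done ()) (step _)
unf-det (step _) (done ())
unf-det (step uf) (step uf′) = unf-det uf uf′

sum⇒¬IsOne : ∀ {u κ bs} → Unf u (sum κ bs) → ¬ IsOne u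
sum⇒¬IsOne uf isOne with unf-det uf isOne
... | ()

act-branch : ∀ {γ u κ bs α c′} → Unf u (sum κ bs) → (γ , u) ─[ act α ]→ c′ →
             Any (λ b → α ≡ lab κ (proj₁ b)) bs
act-branch uf (ext-sum uf′ _ _ b∈) with unf-det uf uf′
... | refl = Any.map (λ { refl → refl }) b∈
act-branch uf (prefix uf′) with unf-det uf uf′
... | refl = here refl

one⇒¬act : ∀ {γ u α c′} → Unf u one → ¬ ((γ , u) ─[ act α ]→ c′)
one⇒¬act uf (ext-sum uf′ _ _ _) with unf-det uf uf′
... | ()
one⇒¬act uf (prefix uf′) with unf-det uf uf′
... | ()

Quiet : Contract → Set
Quiet h = ∀ {γ u c′} → Unf u h → ¬ ((γ , u) ─[ τ ]→ c′)

quiet-one : Quiet one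
quiet-one uf (int-tau uf′ _ _) with unf-det uf uf′
... | ()

quiet-external : ∀ {κ bs} → External κ → Quiet (sum κ bs)
quiet-external ext uf (int-tau uf′ _ _) with unf-det uf uf′
... | refl = ext

quiet-short : ∀ {κ bs} → length bs < 2 → Quiet (sum κ bs)
quiet-short short uf (int-tau uf′ two≤ _) with unf-det uf uf′
... | refl = <⇒≱ short two≤

quiet-unary : ∀ {κ b} → Quiet (sum κ (b ∷ []))
quiet-unary = quiet-short (s≤s (s≤s z≤n))

NoComm : Contract → Contract → Set
NoComm h h′ = ∀ {γc γs ρ σ α c′ s′} → Unf ρ h → Unf σ h′ →
              (γc , ρ) ─[ act α ]→ c′ → (γs , σ) ─[ act (dual α) ]→ s′ → ⊥

noComm-one : ∀ {h} → NoComm h one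
noComm-one _ uσ _ s = one⇒¬act uσ s

noComm-sums : ∀ {κ κ′ bs cs} →
              (∀ {b c} → b ∈ bs → c ∈ cs → dual (lab κ (proj₁ b)) ≢ lab κ′ (proj₁ c)) →
              NoComm (sum κ bs) (sum κ′ cs)
noComm-sums clash uρ uσ c s with find (act-branch uρ c) | find (act-branch uσ s)
... | _ , b∈ , refl | _ , c∈ , eq = clash b∈ c∈ eq

data Dual : Kind → Kind → Set where
  in-outE : Dual In OutE
  in-outI : Dual In OutI
  outE-in : Dual OutE In
  outI-in : Dual OutI In

dual-lab : ∀ {κ κ′} → Dual κ κ′ → ∀ a → dual (lab κ a) ≡ lab κ′ a
dual-lab in-outE a = refl
dual-lab in-outI a = refl
dual-lab outE-in a = refl
dual-lab outI-in a = refl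

dual-lab⁻ : ∀ κ κ′ {a c} → dual (lab κ a) ≡ lab κ′ c → Dual κ κ′ × a ≡ c
dual-lab⁻ In In ()
dual-lab⁻ In OutE refl = in-outE , refl
dual-lab⁻ In OutI refl = in-outI , refl
dual-lab⁻ OutE In refl = outE-in , refl
dual-lab⁻ OutE OutE ()
dual-lab⁻ OutE OutI ()
dual-lab⁻ OutI In refl = outI-in , refl
dual-lab⁻ OutI OutE ()
dual-lab⁻ OutI OutI ()

Dual-sym : ∀ {κ κ′} → Dual κ κ′ → Dual κ′ κ
Dual-sym in-outE = outE-in
Dual-sym in-outI = outI-in
Dual-sym outE-in = in-outE
Dual-sym outI-in = in-outI

isInput : Kind → Bool
isInput In = true
isInput OutE = false
isInput OutI = false

Dual⇒polarity≢ : ∀ {κ κ′} → Dual κ κ′ → isInput κ ≢ isInput κ′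
Dual⇒polarity≢ in-outE ()
Dual⇒polarity≢ in-outI ()
Dual⇒polarity≢ outE-in ()
Dual⇒polarity≢ outI-in ()

relabel : ∀ {c c′ α β} → α ≡ β → c ─[ act α ]→ c′ → c ─[ act β ]→ c′
relabel refl t = t

Retractable : History → Set
Retractable (just _ ∷ _) = ⊤
Retractable _ = ⊥

rb⇒Retractable : ∀ {γ u c′} → (γ , u) ─[ rb ]→ c′ → Retractable γ
rb⇒Retractable rollback = tt

act-rehistory : ∀ {γ u α c′} → (γ , u) ─[ act α ]→ c′ → ∀ γ′ → ∃ λ c″ → (γ′ , u) ─[ act α ]→ c″
act-rehistory (ext-sum uf ext long b∈) γ′ = _ , ext-sum uf ext long b∈
act-rehistory (prefix uf) γ′ = _ , prefix uf

τ-rehistory : ∀ {γ u c′} → (γ , u) ─[ τ ]→ c′ → ∀ γ′ → ∃ λ c″ → (γ′ , u) ─[ τ ]→ c″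
τ-rehistory (int-tau uf long b∈) γ′ = _ , int-tau uf long b∈

Inert : Contract → Contract → Set
Inert ρ σ = ∀ γc γs → ¬ (∃ λ q → ((γc , ρ) , (γs , σ)) ⟶ct q)

inert : ∀ {γc ρ γs σ} → ¬ (∃ λ q → ((γc , ρ) , (γs , σ)) ⟶ct q) → Inert ρ σ
inert {γc} {γs = γs} no-ct _ _ (_ , comm c s) =
  no-ct (_ , comm (proj₂ (act-rehistory c γc)) (proj₂ (act-rehistory s γs)))
inert {γc} no-ct _ _ (_ , τl c) = no-ct (_ , τl (proj₂ (τ-rehistory c γc)))
inert {γs = γs} no-ct _ _ (_ , τr s) = no-ct (_ , τr (proj₂ (τ-rehistory s γs)))

inert-heads : ∀ {ρ σ h h′} → Unf ρ h → Unf σ h′ → Quiet h → Quiet h′ → NoComm h h′ → Inert ρ σ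
inert-heads uρ uσ _ _ no-comm _ _ (_ , comm c s) = no-comm uρ uσ c s
inert-heads uρ uσ quietρ _ _ _ _ (_ , τl c) = quietρ uρ c
inert-heads uρ uσ _ quietσ _ _ _ (_ , τr s) = quietσ uσ s

Stuck : Pair → Set
Stuck P = ¬ (∃ λ Q → P ⟶ Q)

Stuck⇒Inert : ∀ {γc ρ γs σ} → Stuck ((γc , ρ) , (γs , σ)) → Inert ρ σ
Stuck⇒Inert stuck = inert λ (q , c) → stuck (q , ct c)

stuck : ∀ {γc ρ γs σ} → Inert ρ σ → (Retractable γc → Retractable γs → ⊥) →
        Stuck ((γc , ρ) , (γs , σ))
stuck inert _ (_ , ct c) = inert _ _ (_ , c)
stuck _ ¬rb (_ , rbk _ rc rs _) = ¬rb (rb⇒Retractable rc) (rb⇒Retractable rs)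

below : History → Conf → Conf
below h (γ , u) = (γ List.++ h , u)

lts-below : ∀ {c ℓ c′} h → c ─[ ℓ ]→ c′ → below h c ─[ ℓ ]→ below h c′
lts-below h (ext-sum uf ext long b∈) = ext-sum uf ext long b∈
lts-below h (int-tau uf long b∈) = int-tau uf long b∈
lts-below h (prefix uf) = prefix uf
lts-below h rollback = rollback

belowᴾ : History → History → Pair → Pair
belowᴾ hc hs (c , s) = below hc c , below hs s

run-below : ∀ {P Q} hc hs → P ⟶* Q → belowᴾ hc hs P ⟶* belowᴾ hc hs Q
run-below hc hs = gmap (belowᴾ hc hs) step-below
  where
  step-below : ∀ {P Q} → P ⟶ Q → belowᴾ hc hs P ⟶ belowᴾ hc hs Q
  step-below (ct (comm c s)) = ct (comm (lts-below hc c) (lts-below hs s))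
  step-below (ct (τl c)) = ct (τl (lts-below hc c))
  step-below (ct (τr s)) = ct (τr (lts-below hs s))
  step-below (rbk ¬one rc rs no-ct) =
    rbk ¬one (lts-below hc rc) (lts-below hs rs) (inert no-ct _ _)

depth : Label → ℕ → ℕ
depth (act _) n = suc n
depth τ n = n
depth rb n = ℕ.pred n

lts-depth : ∀ {c ℓ c′} → c ─[ ℓ ]→ c′ → length (proj₁ c′) ≡ depth ℓ (length (proj₁ c))
lts-depth (ext-sum _ _ _ _) = refl
lts-depth (int-tau _ _ _) = refl
lts-depth (prefix _) = refl
lts-depth rollback = refl

Balanced : Pair → Set
Balanced ((γc , _) , (γs , _)) = length γc ≡ length γs

run-balanced : ∀ {P Q} → P ⟶* Q → Balanced P → Balanced Q
run-balanced ε bal = bal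
run-balanced (P⟶ ◅ run) bal = run-balanced run (step-balanced P⟶ bal)
  where
  step-balanced : ∀ {P Q} → P ⟶ Q → Balanced P → Balanced Q
  step-balanced (ct (comm c s)) bal = trans (lts-depth c) (trans (cong suc bal) (sym (lts-depth s)))
  step-balanced (ct (τl c)) bal = trans (lts-depth c) bal
  step-balanced (ct (τr s)) bal = trans bal (sym (lts-depth s))
  step-balanced (rbk _ rc rs _) bal =
    trans (lts-depth rc) (trans (cong ℕ.pred bal) (sym (lts-depth rs)))

-- Failing runs

start : Contract → Contract → Pair
start ρ σ = ([] , ρ) , ([] , σ)

FailsFrom : Pair → Set
FailsFrom P = Σ Pair λ Q → P ⟶* Q × Stuck Q × ¬ IsOne (proj₂ (proj₁ Q))

Fails : Contract → Contract → Set
Fails ρ σ = FailsFrom (start ρ σ)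

compliant⇒¬Fails : ∀ {ρ σ} → Compliant ρ σ → ¬ Fails ρ σ
compliant⇒¬Fails compliant (_ , run , stuck , ¬one) = ¬one (compliant _ _ run stuck)

fails-prepend : ∀ {P Q} → P ⟶* Q → FailsFrom Q → FailsFrom P
fails-prepend run (R , run′ , stuck , ¬one) = R , run ◅◅ run′ , stuck , ¬one

fails-inert : ∀ {ρ σ ρ′ σ′} → start ρ σ ⟶* start ρ′ σ′ → Inert ρ′ σ′ → ¬ IsOne ρ′ → Fails ρ σ
fails-inert run inert ¬one = _ , run , stuck inert (λ ()) , ¬one

pushed : Maybe Contract → Maybe Contract → Contract → Contract → Pair
pushed mc ms x y = (mc ∷ [] , x) , (ms ∷ [] , y)

RollsBack : Maybe Contract → Maybe Contract → Pair → Set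
RollsBack mc ms P =
  Σ Contract λ x′ → Σ Contract λ y′ → mc ≡ just x′ × ms ≡ just y′ × P ⟶* start x′ y′

fails-below : ∀ {x y γc x₁ γs y₁} mc ms → start x y ⟶* ((γc , x₁) , (γs , y₁)) →
                 Stuck ((γc , x₁) , (γs , y₁)) → ¬ IsOne x₁ →
                 (Retractable (γc List.++ mc ∷ []) → Retractable (γs List.++ ms ∷ []) → ⊥) →
                 FailsFrom (pushed mc ms x y)
fails-below mc ms run st ¬one ¬rb =
  _ , run-below (mc ∷ []) (ms ∷ []) run , stuck (Stuck⇒Inert st) ¬rb , ¬one

-- Histories stay balanced, so a failing run either ends with both histories non-empty, and
-- then the entries pushed at the bottom are never consulted, or with both empty, and then
-- the pushed entries allow one more rollback exactly when both are retractable.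
lift-failure : ∀ {x y} mc ms → Fails x y →
               FailsFrom (pushed mc ms x y) ⊎ RollsBack mc ms (pushed mc ms x y)
lift-failure (just x′) (just y′) ((([] , _) , ([] , _)) , run , st , ¬one) =
  inj₂ (x′ , y′ , refl , refl ,
        run-below _ _ run ◅◅ rbk ¬one rollback rollback (Stuck⇒Inert st _ _) ◅ ε)
lift-failure nothing ms ((([] , _) , ([] , _)) , run , st , ¬one) =
  inj₁ (fails-below nothing ms run st ¬one λ ())
lift-failure (just _) nothing ((([] , _) , ([] , _)) , run , st , ¬one) =
  inj₁ (fails-below _ nothing run st ¬one λ _ ())
lift-failure mc ms (((just _ ∷ _ , _) , (just _ ∷ _ , _)) , run , st , ¬one) =
  ⊥-elim (st (_ , rbk ¬one rollback rollback (Stuck⇒Inert st _ _)))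
lift-failure mc ms (((nothing ∷ _ , _) , (_ ∷ _ , _)) , run , st , ¬one) =
  inj₁ (fails-below mc ms run st ¬one λ ())
lift-failure mc ms (((just _ ∷ _ , _) , (nothing ∷ _ , _)) , run , st , ¬one) =
  inj₁ (fails-below mc ms run st ¬one λ _ ())
lift-failure mc ms ((([] , _) , (_ ∷ _ , _)) , run , _) =
  contradiction (run-balanced run refl) λ ()
lift-failure mc ms (((_ ∷ _ , _) , ([] , _)) , run , _) =
  contradiction (run-balanced run refl) λ ()

comm-failure : ∀ {ρ σ α mc ms x y} →
               ([] , ρ) ─[ act α ]→ (mc ∷ [] , x) → ([] , σ) ─[ act (dual α) ]→ (ms ∷ [] , y) →
               Fails x y → Fails ρ σ ⊎ RollsBack mc ms (start ρ σ)
comm-failure {ρ} {σ} {mc = mc} {ms} {x} {y} c s fails =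
  Sum.map (fails-prepend first)
          (λ (x′ , y′ , mc≡ , ms≡ , run) → x′ , y′ , mc≡ , ms≡ , first ◅◅ run)
          (lift-failure mc ms fails)
  where
  first : start ρ σ ⟶* pushed mc ms x y
  first = ct (comm c s) ◅ ε

comm-failure-prefixˡ : ∀ {ρ σ α ms x y} →
                       ([] , ρ) ─[ act α ]→ (nothing ∷ [] , x) →
                       ([] , σ) ─[ act (dual α) ]→ (ms ∷ [] , y) → Fails x y → Fails ρ σ
comm-failure-prefixˡ c s fails = Sum.[ id , (λ { (_ , _ , () , _) }) ]′ (comm-failure c s fails)

comm-failure-prefixʳ : ∀ {ρ σ α mc x y} →
                       ([] , ρ) ─[ act α ]→ (mc ∷ [] , x) →
                       ([] , σ) ─[ act (dual α) ]→ (nothing ∷ [] , y) → Fails x y → Fails ρ σ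
comm-failure-prefixʳ c s fails =
  Sum.[ id , (λ { (_ , _ , _ , () , _) }) ]′ (comm-failure c s fails)

ext-step : ∀ {γ ρ κ bs a x} → Unf ρ (sum κ bs) → External κ → (b∈ : (a , x) ∈ bs) →
           Σ (Maybe Contract) λ m → (γ , ρ) ─[ act (lab κ a) ]→ (m ∷ γ , x) ×
                                    (∀ {z} → m ≡ just z → Unf z (sum κ (bs ─ b∈)))
ext-step {bs = _ ∷ _ ∷ _} uf ext b∈ =
  _ , ext-sum uf ext (s≤s (s≤s z≤n)) b∈ , λ { refl → done tt }
ext-step {bs = _ ∷ []} uf ext (here refl) = nothing , prefix uf , λ ()

_⇒τ_ : Contract → Contract → Set
_⇒τ_ = Star λ ρ ρ′ → ([] , ρ) ─[ τ ]→ ([] , ρ′)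

client-τ* : ∀ {ρ ρ′ s} → ρ ⇒τ ρ′ → (([] , ρ) , s) ⟶* (([] , ρ′) , s)
client-τ* {s = s} = gmap (λ ρ → ([] , ρ) , s) λ t → ct (τl t)

server-τ* : ∀ {c σ σ′} → σ ⇒τ σ′ → (c , ([] , σ)) ⟶* (c , ([] , σ′))
server-τ* {c} = gmap (λ σ → c , ([] , σ)) λ t → ct (τr t)

record Committed (ρ : Contract) (a : Name) (x : Contract) : Set where
  constructor committed
  field
    {kind}   : Kind
    {target} : Contract
    output   : Dual kind In
    τs       : ρ ⇒τ target
    unfolds  : Unf target (sum kind ((a , x) ∷ []))

commit : ∀ {ρ bs a x} → IntCh ρ bs → (a , x) ∈ bs → Committed ρ a x
commit {bs = _ ∷ _ ∷ _} (intCh uf) b∈ =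
  committed outE-in (int-tau uf (s≤s (s≤s z≤n)) b∈ ◅ ε) (done tt)
commit {bs = _ ∷ []} (intCh uf) (here refl) = committed outI-in ε uf
commit (unaryE uf) (here refl) = committed outE-in ε uf

record Resolved (ρ : Contract) (κ : Kind) : Set where
  constructor resolved
  field
    {kind}     : Kind
    {target}   : Contract
    {branches} : List (Name × Contract)
    polarity   : isInput kind ≡ isInput κ
    τs         : ρ ⇒τ target
    unfolds    : Unf target (sum kind branches)
    quiet      : Quiet (sum kind branches)

resolve : ∀ {ρ κ bs} → Unf ρ (sum κ bs) → Resolved ρ κ
resolve {κ = In} uf = resolved refl ε uf (quiet-external tt)
resolve {κ = OutE} uf = resolved refl ε uf (quiet-external tt)
resolve {κ = OutI} {[]} uf = resolved refl ε uf (quiet-short (s≤s z≤n))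
resolve {κ = OutI} {_ ∷ []} uf = resolved refl ε uf quiet-unary
resolve {κ = OutI} {_ ∷ _ ∷ _} uf =
  resolved refl (int-tau uf (s≤s (s≤s z≤n)) (here refl) ◅ ε) (done tt) (quiet-external tt)

fails-one-server : ∀ {ρ σ κ bs} → Unf ρ (sum κ bs) → Unf σ one → Fails ρ σ
fails-one-server uρ uσ with resolve uρ
... | resolved _ τs uρ′ quiet =
  fails-inert (client-τ* τs) (inert-heads uρ′ uσ quiet quiet-one noComm-one) (sum⇒¬IsOne uρ′)

fails-same-polarity : ∀ {ρ σ κ κ′ bs cs} → Unf ρ (sum κ bs) → Unf σ (sum κ′ cs) →
                      isInput κ ≡ isInput κ′ → Fails ρ σ
fails-same-polarity uρ uσ same-pol with resolve uρ | resolve uσ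
... | resolved {κ₁} {_} {bs₁} polρ τρ uρ′ quietρ
    | resolved {κ₂} {_} {cs₂} polσ τσ uσ′ quietσ =
  fails-inert (client-τ* τρ ◅◅ server-τ* τσ) (inert-heads uρ′ uσ′ quietρ quietσ no-comm)
              (sum⇒¬IsOne uρ′)
  where
  no-comm : NoComm (sum κ₁ bs₁) (sum κ₂ cs₂)
  no-comm = noComm-sums λ _ _ eq →
    Dual⇒polarity≢ (proj₁ (dual-lab⁻ _ _ eq)) (trans polρ (trans same-pol (sym polσ)))

fails-ext-ext : ∀ {ρ σ κ κ′ bs cs} → Acc _<_ (length bs) → Dual κ κ′ → External κ → External κ′ →
                Unf ρ (sum κ bs) → Unf σ (sum κ′ cs) → AllMatching Fails bs cs → Fails ρ σ
fails-ext-ext {κ = κ} {κ′} {bs} {cs} (acc shorter) d extκ extκ′ uρ uσ all-fail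
  with Any.any? (λ b → Any.any? (λ c → proj₁ c ℕ.≟ proj₁ b) cs) bs
... | no no-match =
  fails-inert ε (inert-heads uρ uσ (quiet-external extκ) (quiet-external extκ′) no-comm)
              (sum⇒¬IsOne uρ)
  where
  no-comm : NoComm (sum κ bs) (sum κ′ cs)
  no-comm = noComm-sums λ b∈ c∈ eq →
    no-match (lose b∈ (lose c∈ (sym (proj₂ (dual-lab⁻ κ κ′ eq)))))
... | yes match with find match
...   | (a , _) , b∈ , c-match with find c-match
...     | _ , c∈ , refl
  with ext-step {γ = []} uρ extκ b∈ | ext-step {γ = []} uσ extκ′ c∈
...     | mc , c-step , residualρ | ms , s-step , residualσ
  with comm-failure c-step (relabel (sym (dual-lab d a)) s-step)
                    (All.lookup (All.lookup all-fail b∈) c∈ refl)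
...       | inj₁ fails = fails
...       | inj₂ (x′ , y′ , mc≡ , ms≡ , run) =
  fails-prepend run (fails-ext-ext (shorter (residual-shorter b∈)) d extκ extκ′
                                   (residualρ mc≡) (residualσ ms≡)
                                   (All.map (─⁺ c∈) (─⁺ b∈ all-fail)))

fails-int-ext : ∀ {ρ σ bs cs a x} → IntCh ρ bs → Unf σ (sum In cs) → (a , x) ∈ bs →
                All (λ c → proj₁ c ≡ a → Fails x (proj₂ c)) cs → Fails ρ σ
fails-int-ext {cs = cs} {a} {x} ic uσ b∈ fail
  with commit ic b∈ | Any.any? (λ c → proj₁ c ℕ.≟ a) cs
... | committed {κ} output τs uρ′ | no ¬named =
  fails-inert (client-τ* τs) (inert-heads uρ′ uσ quiet-unary (quiet-external tt) no-comm)
              (sum⇒¬IsOne uρ′)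
  where
  no-comm : NoComm (sum κ ((a , x) ∷ [])) (sum In cs)
  no-comm = noComm-sums λ { (here refl) c∈ eq →
    ¬named (lose c∈ (sym (proj₂ (dual-lab⁻ κ In eq)))) }
... | committed output τs uρ′ | yes named with find named
...   | (_ , y) , c∈ , refl with ext-step {γ = []} uσ tt c∈
...     | _ , s-step , _ =
  fails-prepend (client-τ* τs)
    (comm-failure-prefixˡ (prefix uρ′) (relabel (sym (dual-lab output a)) s-step)
                          (All.lookup fail c∈ refl))

fails-ext-int : ∀ {ρ σ bs cs a y} → Unf ρ (sum In cs) → IntCh σ bs → (a , y) ∈ bs →
                All (λ c → proj₁ c ≡ a → Fails (proj₂ c) y) cs → Fails ρ σ
fails-ext-int {cs = cs} {a} {y} uρ ic b∈ fail
  with commit ic b∈ | Any.any? (λ c → proj₁ c ℕ.≟ a) cs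
... | committed {κ} output τs uσ′ | no ¬named =
  fails-inert (server-τ* τs) (inert-heads uρ uσ′ (quiet-external tt) quiet-unary no-comm)
              (sum⇒¬IsOne uρ)
  where
  no-comm : NoComm (sum In cs) (sum κ ((a , y) ∷ []))
  no-comm = noComm-sums λ { c∈ (here refl) eq →
    ¬named (lose c∈ (proj₂ (dual-lab⁻ In κ eq))) }
... | committed output τs uσ′ | yes named with find named
...   | (_ , x) , c∈ , refl with ext-step {γ = []} uρ tt c∈
...     | _ , c-step , _ =
  fails-prepend (server-τ* τs)
    (comm-failure-prefixʳ c-step (relabel (sym (dual-lab (Dual-sym output) a)) (prefix uσ′))
                          (All.lookup fail c∈ refl))

-- The search

Outcome : Ctx → Contract → Contract → Set
Outcome Γ ρ σ = (Γ ⊳ ρ ⊣ σ) ⊎ Fails ρ σ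

BranchOutcomes : Ctx → Contract → Contract → Branches → Branches → Set
BranchOutcomes Γ ρ σ bs cs =
  ∀ {b c} → b ∈ bs → c ∈ cs → Outcome ((ρ , σ) ∷ Γ) (proj₂ b) (proj₂ c)

outcome-ext-ext : ∀ {Γ ρ σ κ κ′ bs cs} → Dual κ κ′ → External κ → External κ′ →
                  Unf ρ (sum κ bs) → Unf σ (sum κ′ cs) → BranchOutcomes Γ ρ σ bs cs → Outcome Γ ρ σ
outcome-ext-ext {σ = σ} d extκ extκ′ uρ uσ outcomes with anyMatching⊎allMatching outcomes
... | inj₁ match =
  let a , x , y , b∈ , c∈ , ⊢xy = find-matching match
      σ-branch = Eq.subst (λ α → ExtBr σ α y) (sym (dual-lab d a)) (extBr uσ extκ′ c∈)
  in inj₁ (++ (extBr uρ extκ b∈) σ-branch ⊢xy)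
... | inj₂ all-fail = inj₂ (fails-ext-ext (<-wellFounded _) d extκ extκ′ uρ uσ all-fail)

outcome-int-ext : ∀ {Γ ρ σ bs cs} → Unf ρ (sum OutI bs) → Unf σ (sum In cs) →
                  BranchOutcomes Γ ρ σ bs cs → Outcome Γ ρ σ
outcome-int-ext uρ uσ outcomes with covered⊎uncovered outcomes
... | inj₁ covered = inj₁ (⊕+ (intCh uρ) uσ covered)
... | inj₂ uncovered with find uncovered
...   | _ , b∈ , fail = inj₂ (fails-int-ext (intCh uρ) uσ b∈ fail)

outcome-ext-int : ∀ {Γ ρ σ bs cs} → Unf ρ (sum In cs) → Unf σ (sum OutI bs) →
                  BranchOutcomes Γ ρ σ cs bs → Outcome Γ ρ σ
outcome-ext-int {Γ} {ρ} {σ} uρ uσ outcomes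
  with covered⊎uncovered {R = λ y x → (ρ , σ) ∷ Γ ⊳ x ⊣ y} {S = λ y x → Fails x y}
                         (λ b∈ c∈ → outcomes c∈ b∈)
... | inj₁ covered = inj₁ (+⊕ uρ (intCh uσ) covered)
... | inj₂ uncovered with find uncovered
...   | _ , b∈ , fail = inj₂ (fails-ext-int uρ (intCh uσ) b∈ fail)

outcome-sums : ∀ {Γ ρ σ κ κ′ bs cs} → Unf ρ (sum κ bs) → Unf σ (sum κ′ cs) →
               BranchOutcomes Γ ρ σ bs cs → Outcome Γ ρ σ
outcome-sums {κ = In} {In} uρ uσ _ = inj₂ (fails-same-polarity uρ uσ refl)
outcome-sums {κ = In} {OutE} uρ uσ = outcome-ext-ext in-outE tt tt uρ uσ
outcome-sums {κ = In} {OutI} uρ uσ = outcome-ext-int uρ uσ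
outcome-sums {κ = OutE} {In} uρ uσ = outcome-ext-ext outE-in tt tt uρ uσ
outcome-sums {κ = OutE} {OutE} uρ uσ _ = inj₂ (fails-same-polarity uρ uσ refl)
outcome-sums {κ = OutE} {OutI} uρ uσ _ = inj₂ (fails-same-polarity uρ uσ refl)
outcome-sums {κ = OutI} {In} uρ uσ = outcome-int-ext uρ uσ
outcome-sums {κ = OutI} {OutE} uρ uσ _ = inj₂ (fails-same-polarity uρ uσ refl)
outcome-sums {κ = OutI} {OutI} uρ uσ _ = inj₂ (fails-same-polarity uρ uσ refl)

module Search {Gc Gs : List Contract} (closedc : Closed Gc) (closeds : Closed Gs) where
  module C = Closed-∈ closedc
  module S = Closed-∈ closeds
  open Unvisited _≟ᵖ_
  open import Data.List.Membership.DecPropositional _≟ᵖ_ using (_∈?_)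

  pairs : List (Contract × Contract)
  pairs = cartesianProduct Gc Gs

  search : ∀ Γ → Acc _<_ (unvisited Γ pairs) → ∀ {ρ σ} → ρ ∈ Gc → σ ∈ Gs → Outcome Γ ρ σ
  search Γ (acc smaller) {ρ} {σ} ρ∈ σ∈ with (ρ , σ) ∈? Γ
  ... | yes visited = inj₁ (Hyp (Any.map (λ { refl → C.≈-refl ρ∈ , S.≈-refl σ∈ }) visited))
  ... | no new with Closed.hasHead closedc ρ∈ | Closed.hasHead closeds σ∈
  ...   | _ , uρ , one | _ = inj₁ (Ax uρ)
  ...   | _ , uρ , sum _ _ | _ , uσ , one = inj₂ (fails-one-server uρ uσ)
  ...   | _ , uρ , sum _ _ | _ , uσ , sum _ _ =
    outcome-sums uρ uσ λ b∈ c∈ →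
      search ((ρ , σ) ∷ Γ) (smaller (unvisited-visit Γ pairs (∈-cartesianProduct⁺ ρ∈ σ∈) new))
             (C.branch-∈ (C.unf-∈ ρ∈ uρ) b∈) (S.branch-∈ (S.unf-∈ σ∈ uσ) c∈)

derivable⊎fails : ∀ ρ σ → Contractive ρ → Contractive σ → ([] ⊳ ρ ⊣ σ) ⊎ Fails ρ σ
derivable⊎fails ρ σ cρ cσ =
  Search.search (states-closed ρ cρ) (states-closed σ cσ) [] (<-wellFounded _)
                (∈-states ρ) (∈-states σ)

mainTheorem7 : (ρ σ : Contract) → WF ρ → WF σ → Compliant ρ σ → [] ⊳ ρ ⊣ σ
mainTheorem7 ρ σ wfρ wfσ compliant =
  Sum.[ id , ⊥-elim ∘ compliant⇒¬Fails compliant ]′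
      (derivable⊎fails ρ σ (WF⇒Contractive ρ wfρ) (WF⇒Contractive σ wfσ))
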